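{- Let $X$ be a locally $\mathcal V$-small set. Every $\mathcal V$-covered element of $\mathcal P_{\mathcal V}(X)$ is $\mathcal V$-small if and only if for every map $f:I\to X$ with $I$ a $\mathcal V$-small type, the image $\mathrm{im}(f):=\Sigma_{x:X}\exists_{i:I}f(i)=x$ is $\mathcal V$-small.
   Context: Setting: intensional Martin-Löf type theory with universes, function extensionality, propositional extensionality and propositional truncations ($\exists$ is the truncated $\Sigma$). A type is $\mathcal V$-small if equivalent to a type in $\mathcal V$; a set $X$ is locally $\mathcal V$-small if all identity types $x=y$ are $\mathcal V$-small. $\mathcal P_{\mathcal V}(X):=X\to\Omega_{\mathcal V}$ ($\Omega_{\mathcal V}$ the propositions in $\mathcal V$), with total space $\mathbb T(S):=\Sigma_{x:X}(x\in S)$. $S$ is $\mathcal V$-small if $\mathbb T(S)$ is $\mathcal V$-small, and $\mathcal V$-covered if there is $I:\mathcal V$ with a surjection $I\to\mathbb T(S)$. -}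

{-# OPTIONS --without-K #-}
module Defs where

open import Level using (Level; _⊔_; suc; Setω)
open import Data.Product using (Σ; Σ-syntax; _,_; proj₁; proj₂; _×_)
open import Relation.Binary.PropositionalEquality using (_≡_)

isProp : ∀ {ℓ} → Set ℓ → Set ℓ
isProp A = (x y : A) → x ≡ y

isSet : ∀ {ℓ} → Set ℓ → Set ℓ
isSet A = (x y : A) → isProp (x ≡ y)

FunExt : Setω
FunExt = ∀ {a b} {A : Set a} {B : A → Set b} {f g : (x : A) → B x}
       → ((x : A) → f x ≡ g x) → f ≡ g

PropExt : Setω
PropExt = ∀ {ℓ} {P Q : Set ℓ} → isProp P → isProp Q → (P → Q) → (Q → P) → P ≡ Q

record PropTrunc : Setω where
  field
    ∥_∥      : ∀ {ℓ} → Set ℓ → Set ℓ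
    ∥∥-isProp : ∀ {ℓ} {A : Set ℓ} → isProp ∥ A ∥
    ∣_∣      : ∀ {ℓ} {A : Set ℓ} → A → ∥ A ∥
    ∥∥-rec   : ∀ {ℓ ℓ'} {A : Set ℓ} {P : Set ℓ'} → isProp P → (A → P) → ∥ A ∥ → P

isEquiv : ∀ {a b} {A : Set a} {B : Set b} → (A → B) → Set (a ⊔ b)
isEquiv {A = A} {B} f =
  (Σ[ g ∈ (B → A) ] ((y : B) → f (g y) ≡ y)) × (Σ[ h ∈ (B → A) ] ((x : A) → h (f x) ≡ x))

_≃_ : ∀ {a b} → Set a → Set b → Set (a ⊔ b)
A ≃ B = Σ[ f ∈ (A → B) ] isEquiv f

isSmall : ∀ {ℓ} (𝓥 : Level) → Set ℓ → Set (ℓ ⊔ suc 𝓥)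
isSmall 𝓥 A = Σ[ Y ∈ Set 𝓥 ] (Y ≃ A)

isLocallySmall : ∀ {ℓ} (𝓥 : Level) → Set ℓ → Set (ℓ ⊔ suc 𝓥)
isLocallySmall 𝓥 X = (x y : X) → isSmall 𝓥 (x ≡ y)

Ω : (𝓥 : Level) → Set (suc 𝓥)
Ω 𝓥 = Σ[ P ∈ Set 𝓥 ] isProp P

𝓟 : ∀ {ℓ} (𝓥 : Level) → Set ℓ → Set (ℓ ⊔ suc 𝓥)
𝓟 𝓥 X = X → Ω 𝓥

_∈_ : ∀ {ℓ 𝓥} {X : Set ℓ} → X → 𝓟 𝓥 X → Set 𝓥
x ∈ S = proj₁ (S x)

𝕋 : ∀ {ℓ 𝓥} {X : Set ℓ} → 𝓟 𝓥 X → Set (ℓ ⊔ 𝓥)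
𝕋 {X = X} S = Σ[ x ∈ X ] (x ∈ S)

isSmallSubset : ∀ {ℓ 𝓥} {X : Set ℓ} → 𝓟 𝓥 X → Set (ℓ ⊔ suc 𝓥)
isSmallSubset {𝓥 = 𝓥} S = isSmall 𝓥 (𝕋 S)

module _ (pt : PropTrunc) where
  open PropTrunc pt

  ∃ₜ : ∀ {a b} {A : Set a} → (A → Set b) → Set (a ⊔ b)
  ∃ₜ {A = A} B = ∥ Σ A B ∥

  isSurjection : ∀ {a b} {A : Set a} {B : Set b} → (A → B) → Set (a ⊔ b)
  isSurjection {A = A} {B} e = (y : B) → ∃ₜ (λ (i : A) → e i ≡ y)

  isCovered : ∀ {ℓ 𝓥} {X : Set ℓ} → 𝓟 𝓥 X → Set (ℓ ⊔ suc 𝓥)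
  isCovered {𝓥 = 𝓥} S = Σ[ I ∈ Set 𝓥 ] Σ[ e ∈ (I → 𝕋 S) ] isSurjection e

  image : ∀ {a b} {I : Set a} {X : Set b} → (I → X) → Set (a ⊔ b)
  image {I = I} {X} f = Σ[ x ∈ X ] ∃ₜ (λ (i : I) → f i ≡ x)

record _⇔ω_ {ℓ} (A : Set ℓ) (B : Setω) : Setω where
  field
    to   : A → B
    from : B → A

{-# OPTIONS --without-K #-}
module Submission where

-- Idea: a V-covered subset S, with cover e : I → 𝕋 S, has total space equivalent
-- to the image of proj₁ ∘ e; conversely, for f : I → X with I small, local
-- smallness of X lets the image of f be carved out by the subset
-- x ↦ ∃ i, f i = x with V-small equality, which is covered by I.

open import Level using (Level)
open import Defs
open import Function using (_∘_)
open import Data.Product using (Σ; _,_; proj₁; proj₂)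
open import Relation.Binary.PropositionalEquality using (_≡_; refl; cong; trans; subst)

private
  variable
    a b c : Level
    A B C : Set a

≃-refl : A ≃ A
≃-refl = (λ x → x) , ((λ x → x) , λ _ → refl) , ((λ x → x) , λ _ → refl)

≃-trans : A ≃ B → B ≃ C → A ≃ C
≃-trans (f , (g , fg) , (h , hf)) (f′ , (g′ , fg′) , (h′ , hf′)) =
  f′ ∘ f ,
  (g ∘ g′ , λ z → trans (cong f′ (fg (g′ z))) (fg′ z)) ,
  (h ∘ h′ , λ x → trans (cong h (hf′ (f x))) (hf x))

isSmall-≃ : ∀ {𝓥} → isSmall 𝓥 A → A ≃ B → isSmall 𝓥 B
isSmall-≃ (Y , Y≃A) A≃B = Y , ≃-trans Y≃A A≃B

Σ-≡-prop : {P : A → Set b} → ((x : A) → isProp (P x))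
         → {x y : A} (p : x ≡ y) (u : P x) (v : P y) → _≡_ {A = Σ A P} (x , u) (y , v)
Σ-≡-prop isProp-P refl u v = cong (_ ,_) (isProp-P _ u v)

Σ-≃-fibrewise⇔ : {P : A → Set b} {Q : A → Set c}
               → ((x : A) → isProp (P x)) → ((x : A) → isProp (Q x))
               → ((x : A) → P x → Q x) → ((x : A) → Q x → P x) → Σ A P ≃ Σ A Q
Σ-≃-fibrewise⇔ isProp-P isProp-Q to from =
  (λ (x , u) → x , to x u) ,
  ((λ (x , v) → x , from x v) , λ _ → Σ-≡-prop isProp-Q refl _ _) ,
  ((λ (x , v) → x , from x v) , λ _ → Σ-≡-prop isProp-P refl _ _)

module _ (pt : PropTrunc) where
  open PropTrunc pt

  isEquiv⇒isSurjection : {e : A → B} → isEquiv e → isSurjection pt e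
  isEquiv⇒isSurjection ((g , eg) , _) y = ∣ g y , eg y ∣

  image-∘-surjection : {e : A → B} (f : B → C) → isSurjection pt e
                     → image pt (f ∘ e) ≃ image pt f
  image-∘-surjection {e = e} f e-surj =
    Σ-≃-fibrewise⇔ (λ _ → ∥∥-isProp) (λ _ → ∥∥-isProp)
      (λ _ → ∥∥-rec ∥∥-isProp λ (y , p) → ∣ e y , p ∣)
      (λ x → ∥∥-rec ∥∥-isProp λ (i , p) →
         ∥∥-rec ∥∥-isProp (λ (y , q) → ∣ y , trans (cong f q) p ∣) (e-surj i))

  image-cover≃𝕋 : ∀ {𝓥} {X : Set a} {S : 𝓟 𝓥 X} {e : A → 𝕋 S}
                → isSurjection pt e → image pt (proj₁ ∘ e) ≃ 𝕋 S
  image-cover≃𝕋 {S = S} {e} e-surj =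
    Σ-≃-fibrewise⇔ (λ _ → ∥∥-isProp) (λ x → proj₂ (S x))
      (λ x → ∥∥-rec (proj₂ (S x)) λ (i , p) → subst (_∈ S) p (proj₂ (e i)))
      (λ x s → ∥∥-rec ∥∥-isProp (λ (i , p) → ∣ i , cong proj₁ p ∣) (e-surj (x , s)))

  module _ {𝓥} {X : Set a} (X-locallySmall : isLocallySmall 𝓥 X) where

    private
      _≐_ : X → X → Set 𝓥
      x ≐ y = proj₁ (X-locallySmall x y)

      ≡⇒≐ : {x y : X} → x ≡ y → x ≐ y
      ≡⇒≐ {x} {y} = proj₁ (proj₁ (proj₂ (proj₂ (X-locallySmall x y))))

      ≐⇒≡ : {x y : X} → x ≐ y → x ≡ y
      ≐⇒≡ {x} {y} = proj₁ (proj₂ (X-locallySmall x y))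

    imageSubset : {Y : Set 𝓥} → (Y → X) → 𝓟 𝓥 X
    imageSubset {Y} f x = ∥ Σ Y (λ y → f y ≐ x) ∥ , ∥∥-isProp

    𝕋-imageSubset≃image : {Y : Set 𝓥} (f : Y → X) → 𝕋 (imageSubset f) ≃ image pt f
    𝕋-imageSubset≃image f =
      Σ-≃-fibrewise⇔ (λ _ → ∥∥-isProp) (λ _ → ∥∥-isProp)
        (λ _ → ∥∥-rec ∥∥-isProp λ (y , l) → ∣ y , ≐⇒≡ l ∣)
        (λ _ → ∥∥-rec ∥∥-isProp λ (y , p) → ∣ y , ≡⇒≐ p ∣)

    imageSubset-isCovered : {Y : Set 𝓥} (f : Y → X) → isCovered pt (imageSubset f)
    imageSubset-isCovered {Y} f =
      Y , (λ y → f y , ∣ y , ≡⇒≐ refl ∣) ,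
      λ (x , s) → ∥∥-rec ∥∥-isProp
        (λ (y , l) → ∣ y , Σ-≡-prop (λ _ → ∥∥-isProp) (≐⇒≡ l) _ _ ∣) s

mainTheorem18 : (pt : PropTrunc) → FunExt → PropExt
    → {𝓤 𝓥 : Level} (X : Set 𝓤) → isSet X → isLocallySmall 𝓥 X
    → (((S : 𝓟 𝓥 X) → isCovered pt S → isSmallSubset S)
    ⇔ω
    ({𝓦 : Level} (I : Set 𝓦) → isSmall 𝓥 I → (f : I → X) → isSmall 𝓥 (image pt f)))
mainTheorem18 pt _ _ {𝓥 = 𝓥} X _ X-locallySmall = record { to = to ; from = from }
  where
  to : ((S : 𝓟 𝓥 X) → isCovered pt S → isSmallSubset S)
     → {𝓦 : Level} (I : Set 𝓦) → isSmall 𝓥 I → (f : I → X) → isSmall 𝓥 (image pt f)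
  to covered⇒small I (Y , e , e-equiv) f =
    isSmall-≃ (covered⇒small (imageSubset pt X-locallySmall (f ∘ e))
                             (imageSubset-isCovered pt X-locallySmall (f ∘ e)))
              (≃-trans (𝕋-imageSubset≃image pt X-locallySmall (f ∘ e))
                       (image-∘-surjection pt f (isEquiv⇒isSurjection pt e-equiv)))

  from : ({𝓦 : Level} (I : Set 𝓦) → isSmall 𝓥 I → (f : I → X) → isSmall 𝓥 (image pt f))
       → (S : 𝓟 𝓥 X) → isCovered pt S → isSmallSubset S
  from image-small S (I , e , e-surj) =
    isSmall-≃ (image-small I (I , ≃-refl) (proj₁ ∘ e)) (image-cover≃𝕋 pt {S = S} e-surj)
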